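{- For all integers $k\ge 2$ and $t\ge k+2$ and every $\varepsilon>0$ there is $n_0$ such that for all $n\ge n_0$, $$(1-\varepsilon)\,\mathrm{ex}\big(n,K_{t-1}^{(k)},K_t^{(k)}\big)\le \mathrm{ex}(n,K(t,k))\le (1+\varepsilon)\,\mathrm{ex}\big(n,K_{t-1}^{(k)},K_t^{(k)}\big).$$
   Context: A simplicial complex is a pair $H=(V,E)$ with $E\subseteq\mathscr P(V)$ closed under taking subsets; all sets in $E$ (including the empty set and singletons) count as edges. $K_t^{(k)}$ is the complete $k$-uniform hypergraph on $t$ vertices, and $K(t,k)$ is the simplicial complex on $t$ vertices whose edge set is the downward closure of $K_t^{(k)}$. $H$ contains a copy of $F$ if there is an injection $\varphi:V(F)\to V(H)$ with $\varphi(e)\in E(H)$ for every $e\in E(F)$. $\mathrm{ex}(n,F)$ is the maximum number of edges of a simplicial complex on $n$ vertices containing no copy of $F$. For $k$-graphs $F,G$, $\mathrm{ex}(n,F,G)$ is the maximum number of copies of $F$ in a $k$-graph on $n$ vertices containing no copy of $G$.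
   Formalization: The parameter ε ranges over the positive rationals. -}

module Defs where

open import Data.Bool using (Bool; true; false; T; _∧_; _∨_; not)
open import Data.Nat using (ℕ; zero; suc; _≤_; _≤ᵇ_; _≡ᵇ_)
open import Data.Nat.Properties using (≤ᵇ⇒≤; ≤⇒≤ᵇ; ≤-trans)
open import Data.Fin using (Fin; _≟_)
open import Data.Fin.Properties using (any?)
open import Data.Fin.Subset using (Subset; _⊆_; ∣_∣; _∈_)
open import Data.Fin.Subset.Properties using (_∈?_; _⊆?_; p⊆q⇒∣p∣≤∣q∣)
open import Data.Vec using ([]; _∷_; tabulate)
open import Data.List using (List; [_]; _++_; map; length; filterᵇ; foldr)
open import Data.Product using (Σ; _×_; ∃)
open import Relation.Nullary using (¬_; ⌊_⌋)
open import Relation.Nullary.Decidable using (_×-dec_)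
open import Relation.Binary.PropositionalEquality using (_≡_)
open import Function.Definitions using (Injective)

allSubsets : (n : ℕ) → List (Subset n)
allSubsets zero = [ [] ]
allSubsets (suc n) = map (true ∷_) (allSubsets n) ++ map (false ∷_) (allSubsets n)

image : ∀ {m n} → (Fin m → Fin n) → Subset m → Subset n
image φ s = tabulate (λ j → ⌊ any? (λ i → (i ∈? s) ×-dec (φ i ≟ j)) ⌋)

record SimplicialComplex (n : ℕ) : Set where
  field
    E      : Subset n → Bool
    closed : ∀ {s s′ : Subset n} → s′ ⊆ s → T (E s) → T (E s′)
open SimplicialComplex public

-- number of edges (all sets in E, including ∅ and singletons)
edgeCount : ∀ {n} → SimplicialComplex n → ℕ
edgeCount {n} H = length (filterᵇ (E H) (allSubsets n))

ContainsSC : ∀ {m n} → SimplicialComplex n → SimplicialComplex m → Set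
ContainsSC H F = Σ (_ → _) λ φ → Injective _≡_ _≡_ φ × (∀ s → T (E F s) → T (E H (image φ s)))

-- K(t,k): downward closure of K_t^{(k)}, i.e. all subsets of size ≤ k of Fin t
K[_,_] : (t k : ℕ) → SimplicialComplex t
K[ t , k ] = record
  { E = λ s → ∣ s ∣ ≤ᵇ k
  ; closed = λ s′⊆s e → ≤⇒≤ᵇ (≤-trans (p⊆q⇒∣p∣≤∣q∣ s′⊆s) (≤ᵇ⇒≤ _ _ e)) }

IsExSC : (n : ℕ) → ∀ {m} → SimplicialComplex m → ℕ → Set
IsExSC n F e =
  (Σ (SimplicialComplex n) λ H → ¬ ContainsSC H F × edgeCount H ≡ e)
  × (∀ (H : SimplicialComplex n) → ¬ ContainsSC H F → edgeCount H ≤ e)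

record KGraph (n k : ℕ) : Set where
  field
    edge    : Subset n → Bool
    uniform : ∀ s → T (edge s) → ∣ s ∣ ≡ k
open KGraph public

Kc : (t k : ℕ) → KGraph t k
Kc t k = record { edge = λ s → ∣ s ∣ ≡ᵇ k ; uniform = λ s e → Data.Nat.Properties.≡ᵇ⇒≡ ∣ s ∣ k e }

ContainsKG : ∀ {m n k} → KGraph n k → KGraph m k → Set
ContainsKG G F = Σ (_ → _) λ φ → Injective _≡_ _≡_ φ × (∀ s → T (edge F s) → T (edge G (image φ s)))

allᵇ : ∀ {A : Set} → (A → Bool) → List A → Bool
allᵇ p = foldr (λ x b → p x ∧ b) true

spansClique : ∀ {n k} → KGraph n k → Subset n → Bool
spansClique {n} {k} G S =
  allᵇ (λ s → not (⌊ s ⊆? S ⌋ ∧ (∣ s ∣ ≡ᵇ k)) ∨ edge G s) (allSubsets n)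

-- number of copies of K_r^{(k)} in G (copies = r-vertex sets spanning a clique)
cliqueCopies : ∀ {n k} → KGraph n k → ℕ → ℕ
cliqueCopies {n} G r = length (filterᵇ (λ S → (∣ S ∣ ≡ᵇ r) ∧ spansClique G S) (allSubsets n))

IsExCl : (n k r t : ℕ) → ℕ → Set
IsExCl n k r t e =
  (Σ (KGraph n k) λ G → ¬ ContainsKG G (Kc t k) × cliqueCopies G r ≡ e)
  × (∀ (G : KGraph n k) → ¬ ContainsKG G (Kc t k) → cliqueCopies G r ≤ e)

-- Both quantities are governed by (t-1)-cliques. Downward-closing the (t-1)-cliques of a
-- K_t^(k)-free k-graph gives a K(t,k)-free complex, so ex(n, K_{t-1}, K_t) ≤ ex(n, K(t,k)).
-- Conversely a K(t,k)-free complex has no face on t vertices, its faces on t-1 vertices are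
-- cliques of its K_t^(k)-free k-skeleton, and the remaining faces number at most (n+1)^(t-2).
-- This error term is negligible, since the complete (t-1)-partite k-graph with parts of size
-- ⌊n/(t-1)⌋ is K_t^(k)-free (pigeonhole, using k ≥ 2) with ⌊n/(t-1)⌋^(t-1) cliques of size t-1.
module Submission where

open import Defs

-- Scoped so that the ℕ operators _*_, _<_ and _/_ do not clash with the ℚ ones below.
module _ where
  open import Data.Bool using (Bool; true; false; T; _∧_; _∨_; not)
  open import Data.Bool.Properties using (T-∧; T-∨; T-≡)
  open import Data.Empty using (⊥-elim)
  open import Data.Unit using (tt)
  open import Data.Fin as Fin using (Fin; zero; suc; toℕ; fromℕ<; inject≤; combine; finToFun; funToFin)
  import Data.Fin.Properties as Fin
  open import Data.Fin.Subset using (Subset; _⊆_; _∈_; ∣_∣; _∪_; ⁅_⁆; ⊤; inside; outside)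
  open import Data.Fin.Subset.Properties
    using (_∈?_; _⊆?_; ∈⊤; ⊆-refl; ⊆-trans; s⊆s; ∣⊤∣≡n; ∣⁅x⁆∣≡1; x∈⁅x⁆; x∈p∪q⁺; anySubset?)
  open import Data.List using (List; []; _∷_; _++_; map; length; filterᵇ)
  open import Data.List.Membership.Propositional renaming (_∈_ to _∈ₗ_)
  open import Data.List.Membership.Propositional.Properties using (∈-map⁺; ∈-++⁺ˡ; ∈-++⁺ʳ; ∈-filter⁺)
  import Data.List.Membership.Setoid.Properties as Membership
  open import Data.List.Properties using (filter-++; length-++)
  open import Data.List.Relation.Unary.Any using (here; there; index)
  open import Data.Nat using (ℕ; zero; suc; _+_; _*_; _^_; _≤_; _<_; _≡ᵇ_; _<ᵇ_; z≤n; s≤s; NonZero)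
  open import Data.Nat.DivMod using (_/_; _%_; m%n<n; m≡m%n+[m/n]*n; m*n/n≡m; m/n*n≤m; /-monoˡ-≤;
    +-distrib-/-∣ˡ; m<n⇒m/n≡0)
  open import Data.Nat.Divisibility using (m∣m*n)
  open import Data.Nat.Properties
  open import Algebra.Properties.CommutativeSemigroup *-commutativeSemigroup using (interchange)
  open import Data.Product using (∃; _×_; _,_; proj₁; proj₂)
  open import Data.Sum using (inj₁; inj₂)
  open import Data.Vec using ([]; _∷_; here; there)
  open import Data.Vec.Properties using ([]=⇒lookup; lookup⇒[]=; lookup∘tabulate)
  open import Function using (_∘_)
  open import Function.Bundles using (Equivalence)
  open import Function.Definitions using (Injective)
  open import Relation.Binary.PropositionalEquality
  open import Relation.Nullary using (¬_; Dec; yes; no)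
  open import Relation.Nullary.Decidable using (⌊_⌋; T?; toWitness; fromWitness; _×-dec_; _→-dec_)

  count : ∀ {A : Set} → (A → Bool) → List A → ℕ
  count p xs = length (filterᵇ p xs)

  count-++ : ∀ {A : Set} (p : A → Bool) xs ys → count p (xs ++ ys) ≡ count p xs + count p ys
  count-++ p xs ys = trans (cong length (filter-++ (T? ∘ p) xs ys)) (length-++ (filterᵇ p xs))

  count-map : ∀ {A B : Set} (p : B → Bool) (f : A → B) xs → count p (map f xs) ≡ count (p ∘ f) xs
  count-map p f [] = refl
  count-map p f (x ∷ xs) with p (f x)
  ... | true  = cong suc (count-map p f xs)
  ... | false = count-map p f xs

  count-false : ∀ {A : Set} (xs : List A) → count (λ _ → false) xs ≡ 0
  count-false []       = refl
  count-false (x ∷ xs) = count-false xs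

  count-mono : ∀ {A : Set} {p q : A → Bool} → (∀ x → T (p x) → T (q x)) → ∀ xs → count p xs ≤ count q xs
  count-mono                 p⇒q []       = z≤n
  count-mono {p = p} {q = q} p⇒q (x ∷ xs) with p x | q x | p⇒q x
  ... | true  | true  | _   = s≤s (count-mono p⇒q xs)
  ... | true  | false | px⇒ = ⊥-elim (px⇒ _)
  ... | false | true  | _   = m≤n⇒m≤1+n (count-mono p⇒q xs)
  ... | false | false | _   = count-mono p⇒q xs

  count-∨ : ∀ {A : Set} (p q : A → Bool) xs → count (λ x → p x ∨ q x) xs ≤ count p xs + count q xs
  count-∨ p q []       = z≤n
  count-∨ p q (x ∷ xs) with p x | q x
  ... | true  | true  = s≤s (≤-trans (count-∨ p q xs) (+-monoʳ-≤ (count p xs) (n≤1+n _)))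
  ... | true  | false = s≤s (count-∨ p q xs)
  ... | false | true  = ≤-trans (s≤s (count-∨ p q xs)) (≤-reflexive (sym (+-suc _ _)))
  ... | false | false = count-∨ p q xs

  injection⇒≤count : ∀ {A : Set} {m} (p : A → Bool) {xs} (h : Fin m → A) → Injective _≡_ _≡_ h →
                     (∀ i → h i ∈ₗ xs) → (∀ i → T (p (h i))) → m ≤ count p xs
  injection⇒≤count {A} p {xs} h h-inj h∈xs ph = Fin.injective⇒≤ {f = index ∘ h∈filter}
    (λ eq → h-inj (Membership.index-injective (setoid A) (h∈filter _) (h∈filter _) eq))
    where
    h∈filter : ∀ i → h i ∈ₗ filterᵇ p xs
    h∈filter i = ∈-filter⁺ (T? ∘ p) (h∈xs i) (ph i)

  ∈-allSubsets : ∀ {n} (s : Subset n) → s ∈ₗ allSubsets n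
  ∈-allSubsets []             = here refl
  ∈-allSubsets (inside ∷ s)   = ∈-++⁺ˡ (∈-map⁺ (inside ∷_) (∈-allSubsets s))
  ∈-allSubsets {suc n} (outside ∷ s) =
    ∈-++⁺ʳ (map (inside ∷_) (allSubsets n)) (∈-map⁺ (outside ∷_) (∈-allSubsets s))

  countSubsets : ∀ {n} → (Subset n → Bool) → ℕ
  countSubsets {n} p = count p (allSubsets n)

  countSubsets-suc : ∀ n (p : Subset (suc n) → Bool) →
                     countSubsets p ≡ countSubsets (p ∘ (inside ∷_)) + countSubsets (p ∘ (outside ∷_))
  countSubsets-suc n p = trans (count-++ p (map (inside ∷_) (allSubsets n)) _)
    (cong₂ _+_ (count-map p (inside ∷_) (allSubsets n)) (count-map p (outside ∷_) (allSubsets n)))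

  countSubsets-∣∣<-≤ : ∀ n q → countSubsets {n} (λ s → ∣ s ∣ <ᵇ suc q) ≤ suc n ^ q
  countSubsets-∣∣<-≤ zero    q       = ≤-reflexive (sym (^-zeroˡ q))
  countSubsets-∣∣<-≤ (suc n) zero
    rewrite countSubsets-suc n (λ s → ∣ s ∣ <ᵇ 1) | count-false (allSubsets n) = countSubsets-∣∣<-≤ n zero
  countSubsets-∣∣<-≤ (suc n) (suc q) = begin
    countSubsets {suc n} (λ s → ∣ s ∣ <ᵇ suc (suc q))
      ≡⟨ countSubsets-suc n (λ s → ∣ s ∣ <ᵇ suc (suc q)) ⟩
    countSubsets {n} (λ s → ∣ s ∣ <ᵇ suc q) + countSubsets {n} (λ s → ∣ s ∣ <ᵇ suc (suc q))
      ≤⟨ +-mono-≤ (countSubsets-∣∣<-≤ n q) (countSubsets-∣∣<-≤ n (suc q)) ⟩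
    suc n ^ q + suc n * suc n ^ q
      ≤⟨ +-mono-≤ (^-monoˡ-≤ q (n≤1+n _)) (*-monoʳ-≤ (suc n) (^-monoˡ-≤ q (n≤1+n _))) ⟩
    suc (suc n) ^ q + suc n * suc (suc n) ^ q                                  ∎
    where open ≤-Reasoning

  record Enumeration {n} (s : Subset n) : Set where
    field
      point     : Fin ∣ s ∣ → Fin n
      injective : Injective _≡_ _≡_ point
      point∈    : ∀ i → point i ∈ s
      onto      : ∀ {x} → x ∈ s → ∃ λ i → point i ≡ x

  enumerate : ∀ {n} (s : Subset n) → Enumeration s
  enumerate []            = record { point = λ () ; injective = λ {} ; point∈ = λ () ; onto = λ () }
  enumerate (inside ∷ s)  =
    record { point = point′ ; injective = injective′ ; point∈ = point∈′ ; onto = onto′ }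
    where
    open Enumeration (enumerate s)
    point′ : Fin (suc ∣ s ∣) → Fin _
    point′ zero    = zero
    point′ (suc i) = suc (point i)
    injective′ : Injective _≡_ _≡_ point′
    injective′ {zero}  {zero}  _  = refl
    injective′ {suc i} {suc j} eq = cong suc (injective (Fin.suc-injective eq))
    point∈′ : ∀ i → point′ i ∈ inside ∷ s
    point∈′ zero    = here
    point∈′ (suc i) = there (point∈ i)
    onto′ : ∀ {x} → x ∈ inside ∷ s → ∃ λ i → point′ i ≡ x
    onto′ here       = zero , refl
    onto′ (there x∈) = let i , eq = onto x∈ in suc i , cong suc eq
  enumerate (outside ∷ s) = record
    { point     = suc ∘ point
    ; injective = injective ∘ Fin.suc-injective
    ; point∈    = λ i → there (point∈ i)
    ; onto      = λ { (there x∈) → let i , eq = onto x∈ in i , cong suc eq }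
    }
    where open Enumeration (enumerate s)

  injection⇒≤∣∣ : ∀ {m n} {s : Subset n} (f : Fin m → Fin n) → Injective _≡_ _≡_ f →
                  (∀ i → f i ∈ s) → m ≤ ∣ s ∣
  injection⇒≤∣∣ {s = s} f f-inj f∈s = Fin.injective⇒≤ {f = proj₁ ∘ index-of}
    (λ {i} {j} eq → f-inj (trans (sym (proj₂ (index-of i))) (trans (cong point eq) (proj₂ (index-of j)))))
    where
    open Enumeration (enumerate s)
    index-of : ∀ i → ∃ λ j → point j ≡ f i
    index-of i = onto (f∈s i)

  module _ {m n} (φ : Fin m → Fin n) where

    ∈-image⁺ : ∀ {s i} → i ∈ s → φ i ∈ image φ s
    ∈-image⁺ {s} {i} i∈s = lookup⇒[]= (φ i) (image φ s)
      (trans (lookup∘tabulate _ (φ i)) (Equivalence.to T-≡ (fromWitness (i , i∈s , refl))))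

    ∈-image⁻ : ∀ {s j} → j ∈ image φ s → ∃ λ i → i ∈ s × φ i ≡ j
    ∈-image⁻ {s} {j} j∈ = toWitness (Equivalence.from T-≡ (trans (sym (lookup∘tabulate _ j)) ([]=⇒lookup j∈)))

    image-⊆ : ∀ {s t} → (∀ {i} → i ∈ s → φ i ∈ t) → image φ s ⊆ t
    image-⊆ φ[s]⊆t j∈ with ∈-image⁻ j∈
    ... | i , i∈s , refl = φ[s]⊆t i∈s

    image-mono : ∀ {s s′} → s ⊆ s′ → image φ s ⊆ image φ s′
    image-mono s⊆s′ = image-⊆ (∈-image⁺ ∘ s⊆s′)

    ∣image∣≡∣∣ : Injective _≡_ _≡_ φ → ∀ s → ∣ image φ s ∣ ≡ ∣ s ∣
    ∣image∣≡∣∣ φ-inj s = ≤-antisym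
      (injection⇒≤∣∣ (proj₁ ∘ preimage) preimage-injective (proj₁ ∘ proj₂ ∘ preimage))
      (injection⇒≤∣∣ (φ ∘ point) (injective ∘ φ-inj) (∈-image⁺ ∘ point∈))
      where
      open Enumeration (enumerate s)
      module E = Enumeration (enumerate (image φ s))
      preimage : ∀ i → ∃ λ x → x ∈ s × φ x ≡ E.point i
      preimage i = ∈-image⁻ (E.point∈ i)
      preimage-injective : Injective _≡_ _≡_ (proj₁ ∘ preimage)
      preimage-injective {i} {j} eq =
        E.injective (trans (sym (proj₂ (proj₂ (preimage i)))) (trans (cong φ eq) (proj₂ (proj₂ (preimage j)))))

  ⊆-extendToSize : ∀ {t} (p : Subset t) {k} → ∣ p ∣ ≤ k → k ≤ t → ∃ λ s → p ⊆ s × ∣ s ∣ ≡ k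
  ⊆-extendToSize {t} p {k} p≤k k≤t with m≤n⇒m<n∨m≡n k≤t
  ... | inj₂ refl = ⊤ , (λ _ → ∈⊤) , ∣⊤∣≡n t
  ⊆-extendToSize (inside ∷ p) {suc k} (s≤s p≤k) _ | inj₁ (s≤s k<t) =
    let s , p⊆s , ∣s∣≡k = ⊆-extendToSize p p≤k (<⇒≤ k<t) in inside ∷ s , s⊆s p⊆s , cong suc ∣s∣≡k
  ⊆-extendToSize (outside ∷ p) p≤k _ | inj₁ (s≤s k≤t) =
    let s , p⊆s , ∣s∣≡k = ⊆-extendToSize p p≤k k≤t in outside ∷ s , s⊆s p⊆s , ∣s∣≡k

  ∣p∪q∣≤∣p∣+∣q∣ : ∀ {n} (p q : Subset n) → ∣ p ∪ q ∣ ≤ ∣ p ∣ + ∣ q ∣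
  ∣p∪q∣≤∣p∣+∣q∣ []            []            = z≤n
  ∣p∪q∣≤∣p∣+∣q∣ (inside ∷ p)  (inside ∷ q)  = s≤s (≤-trans (∣p∪q∣≤∣p∣+∣q∣ p q) (+-monoʳ-≤ ∣ p ∣ (n≤1+n _)))
  ∣p∪q∣≤∣p∣+∣q∣ (inside ∷ p)  (outside ∷ q) = s≤s (∣p∪q∣≤∣p∣+∣q∣ p q)
  ∣p∪q∣≤∣p∣+∣q∣ (outside ∷ p) (inside ∷ q)  = ≤-trans (s≤s (∣p∪q∣≤∣p∣+∣q∣ p q)) (≤-reflexive (sym (+-suc _ _)))
  ∣p∪q∣≤∣p∣+∣q∣ (outside ∷ p) (outside ∷ q) = ∣p∪q∣≤∣p∣+∣q∣ p q

  superset-of-pair : ∀ {t k} → 2 ≤ k → k ≤ t → (i j : Fin t) → ∃ λ u → i ∈ u × j ∈ u × ∣ u ∣ ≡ k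
  superset-of-pair {k = k} 2≤k k≤t i j =
    let u , ij⊆u , ∣u∣≡k = ⊆-extendToSize (⁅ i ⁆ ∪ ⁅ j ⁆) ∣ij∣≤k k≤t
    in u , ij⊆u (x∈p∪q⁺ (inj₁ (x∈⁅x⁆ i))) , ij⊆u (x∈p∪q⁺ (inj₂ (x∈⁅x⁆ j))) , ∣u∣≡k
    where
    ∣ij∣≤k : ∣ ⁅ i ⁆ ∪ ⁅ j ⁆ ∣ ≤ k
    ∣ij∣≤k = ≤-trans (∣p∪q∣≤∣p∣+∣q∣ ⁅ i ⁆ ⁅ j ⁆) (subst (_≤ k) (sym (cong₂ _+_ (∣⁅x⁆∣≡1 i) (∣⁅x⁆∣≡1 j))) 2≤k)

  allᵇ⁺ : ∀ {A : Set} (p : A → Bool) xs → (∀ x → T (p x)) → T (allᵇ p xs)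
  allᵇ⁺ p []       _  = tt
  allᵇ⁺ p (x ∷ xs) px = Equivalence.from T-∧ (px x , allᵇ⁺ p xs px)

  allᵇ⁻ : ∀ {A : Set} (p : A → Bool) xs → T (allᵇ p xs) → ∀ {x} → x ∈ₗ xs → T (p x)
  allᵇ⁻ p (y ∷ xs) all (here refl) = proj₁ (Equivalence.to T-∧ all)
  allᵇ⁻ p (y ∷ xs) all (there x∈)  = allᵇ⁻ p xs (proj₂ (Equivalence.to (T-∧ {p y}) all)) x∈

  isClique : ∀ {n k} → KGraph n k → ℕ → Subset n → Bool
  isClique G r S = (∣ S ∣ ≡ᵇ r) ∧ spansClique G S

  module _ {n k} (G : KGraph n k) where

    spansClique⁺ : ∀ {S} → (∀ {s} → s ⊆ S → ∣ s ∣ ≡ k → T (edge G s)) → T (spansClique G S)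
    spansClique⁺ {S} edges = allᵇ⁺ _ (allSubsets n) check
      where
      check : ∀ s → T (not (⌊ s ⊆? S ⌋ ∧ (∣ s ∣ ≡ᵇ k)) ∨ edge G s)
      check s with s ⊆? S | ∣ s ∣ ≡ᵇ k in ∣s∣≡ᵇk
      ... | no _    | _     = tt
      ... | yes _   | false = tt
      ... | yes s⊆S | true  = edges s⊆S (≡ᵇ⇒≡ _ _ (subst T (sym ∣s∣≡ᵇk) tt))

    spansClique⁻ : ∀ {S s} → T (spansClique G S) → s ⊆ S → ∣ s ∣ ≡ k → T (edge G s)
    spansClique⁻ {S} {s} S-clique s⊆S ∣s∣≡k with allᵇ⁻ _ (allSubsets n) S-clique (∈-allSubsets s)
    ... | check with s ⊆? S | ∣ s ∣ ≡ᵇ k | ≡⇒≡ᵇ ∣ s ∣ k ∣s∣≡k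
    ...   | yes _   | true | _ = check
    ...   | no s⊈S  | _    | _ = ⊥-elim (s⊈S s⊆S)

    isClique⁺ : ∀ {r S} → ∣ S ∣ ≡ r → (∀ {s} → s ⊆ S → ∣ s ∣ ≡ k → T (edge G s)) → T (isClique G r S)
    isClique⁺ {r} ∣S∣≡r edges = Equivalence.from T-∧ (≡⇒≡ᵇ _ r ∣S∣≡r , spansClique⁺ edges)

    isClique-edges : ∀ {r S s} → T (isClique G r S) → s ⊆ S → ∣ s ∣ ≡ k → T (edge G s)
    isClique-edges {r} {S} S-clique = spansClique⁻ (proj₂ (Equivalence.to (T-∧ {∣ S ∣ ≡ᵇ r}) S-clique))

  largeFace⇒contains : ∀ {n m} (H : SimplicialComplex n) {s} → T (E H s) → m ≤ ∣ s ∣ →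
                       (F : SimplicialComplex m) → ContainsSC H F
  largeFace⇒contains H {s} s∈H m≤∣s∣ F = φ , φ-injective , λ u _ → closed H (image-⊆ φ (λ _ → point∈ _)) s∈H
    where
    open Enumeration (enumerate s)
    φ : Fin _ → Fin _
    φ i = point (inject≤ i m≤∣s∣)
    φ-injective : Injective _≡_ _≡_ φ
    φ-injective eq = Fin.inject≤-injective m≤∣s∣ m≤∣s∣ _ _ (injective eq)

  free⇒faces< : ∀ {n t k} (H : SimplicialComplex n) → ¬ ContainsSC H K[ t , k ] → ∀ s → T (E H s) → ∣ s ∣ < t
  free⇒faces< H H-free s s∈H = ≰⇒> (λ t≤∣s∣ → H-free (largeFace⇒contains H s∈H t≤∣s∣ K[ _ , _ ]))

  skeleton : ∀ {n} → SimplicialComplex n → (k : ℕ) → KGraph n k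
  skeleton H k = record
    { edge    = λ s → E H s ∧ (∣ s ∣ ≡ᵇ k)
    ; uniform = λ s e → ≡ᵇ⇒≡ _ _ (proj₂ (Equivalence.to (T-∧ {E H s}) e))
    }

  skeleton-free : ∀ {n k t} (H : SimplicialComplex n) → k ≤ t → ¬ ContainsSC H K[ t , k ] →
                  ¬ ContainsKG (skeleton H k) (Kc t k)
  skeleton-free H k≤t H-free (φ , φ-injective , φ-edge) = H-free (φ , φ-injective , φ-face)
    where
    φ-face : ∀ u → T (E K[ _ , _ ] u) → T (E H (image φ u))
    φ-face u ∣u∣≤k =
      let s , u⊆s , ∣s∣≡k = ⊆-extendToSize u (≤ᵇ⇒≤ _ _ ∣u∣≤k) k≤t
      in closed H (image-mono φ u⊆s) (proj₁ (Equivalence.to T-∧ (φ-edge s (≡⇒≡ᵇ _ _ ∣s∣≡k))))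

  face⇒isClique : ∀ {n} (H : SimplicialComplex n) k {s} → T (E H s) → T (isClique (skeleton H k) ∣ s ∣ s)
  face⇒isClique H k s∈H = isClique⁺ (skeleton H k) refl
    (λ s′⊆s ∣s′∣≡k → Equivalence.from T-∧ (closed H s′⊆s s∈H , ≡⇒≡ᵇ _ _ ∣s′∣≡k))

  edgeCount≤cliques+small : ∀ {n} (H : SimplicialComplex n) k r → (∀ s → T (E H s) → ∣ s ∣ ≤ r) →
                            edgeCount H ≤ cliqueCopies (skeleton H k) r + countSubsets {n} (λ s → ∣ s ∣ <ᵇ r)
  edgeCount≤cliques+small {n} H k r faces≤r =
    ≤-trans (count-mono classify (allSubsets n)) (count-∨ (isClique (skeleton H k) r) _ (allSubsets n))
    where
    classify : ∀ s → T (E H s) → T (isClique (skeleton H k) r s ∨ (∣ s ∣ <ᵇ r))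
    classify s s∈H with m≤n⇒m<n∨m≡n (faces≤r s s∈H)
    ... | inj₁ ∣s∣<r = Equivalence.from T-∨ (inj₂ (<⇒<ᵇ ∣s∣<r))
    ... | inj₂ refl  = Equivalence.from T-∨ (inj₁ (face⇒isClique H k s∈H))

  module _ {n k} (G : KGraph n k) (r : ℕ) where

    InClique : Subset n → Set
    InClique s = ∃ λ S → s ⊆ S × T (isClique G r S)

    inClique? : ∀ s → Dec (InClique s)
    inClique? s = anySubset? (λ S → (s ⊆? S) ×-dec T? (isClique G r S))

    InClique-⊆ : ∀ {s s′} → s′ ⊆ s → InClique s → InClique s′
    InClique-⊆ s′⊆s (S , s⊆S , S-clique) = S , ⊆-trans s′⊆s s⊆S , S-clique

    clique⇒InClique : ∀ {S} → T (isClique G r S) → InClique S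
    clique⇒InClique S-clique = _ , ⊆-refl , S-clique

    cliqueComplex : SimplicialComplex n
    cliqueComplex = record
      { E      = λ s → ⌊ inClique? s ⌋
      ; closed = λ s′⊆s → fromWitness ∘ InClique-⊆ s′⊆s ∘ toWitness
      }

  cliqueCopies≤edgeCount : ∀ {n k} (G : KGraph n k) r → cliqueCopies G r ≤ edgeCount (cliqueComplex G r)
  cliqueCopies≤edgeCount {n} G r = count-mono (λ _ → fromWitness ∘ clique⇒InClique G r) (allSubsets n)

  cliqueComplex-free : ∀ {n k t} (G : KGraph n k) r → ¬ ContainsKG G (Kc t k) →
                       ¬ ContainsSC (cliqueComplex G r) K[ t , k ]
  cliqueComplex-free {k = k} G r G-free (φ , φ-injective , φ-face) = G-free (φ , φ-injective , φ-edge)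
    where
    φ-edge : ∀ u → T (∣ u ∣ ≡ᵇ k) → T (edge G (image φ u))
    φ-edge u ∣u∣≡ᵇk =
      let ∣u∣≡k = ≡ᵇ⇒≡ _ _ ∣u∣≡ᵇk
          S , φ[u]⊆S , S-clique = toWitness (φ-face u (≤⇒≤ᵇ (≤-reflexive ∣u∣≡k)))
      in isClique-edges G S-clique φ[u]⊆S (trans (∣image∣≡∣∣ φ φ-injective u) ∣u∣≡k)

  funToFin-cong : ∀ {m n} {f g : Fin m → Fin n} → (∀ i → f i ≡ g i) → funToFin f ≡ funToFin g
  funToFin-cong {zero}  _   = refl
  funToFin-cong {suc m} f≗g = cong₂ combine (f≗g zero) (funToFin-cong (f≗g ∘ suc))

  finToFun-injective : ∀ {m n} {x y : Fin (m ^ n)} → (∀ i → finToFun {m} {n} x i ≡ finToFun y i) → x ≡ y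
  finToFun-injective {m} {n} {x} {y} x≗y =
    trans (sym (Fin.funToFin-finToFin {n} {m} x))
          (trans (funToFin-cong x≗y) (Fin.funToFin-finToFin {n} {m} y))

  module Rainbow {n} (colour : Fin n → ℕ) (r : ℕ) where

    IsRainbow : Subset n → Set
    IsRainbow s = (∀ x → x ∈ s → colour x < r) × (∀ x y → x ∈ s → y ∈ s → colour x ≡ colour y → x ≡ y)

    isRainbow? : ∀ s → Dec (IsRainbow s)
    isRainbow? s =
      Fin.all? (λ x → (x ∈? s) →-dec (colour x <? r)) ×-dec
      Fin.all? (λ x → Fin.all? (λ y → (x ∈? s) →-dec (y ∈? s) →-dec (colour x ≟ colour y) →-dec (x Fin.≟ y)))

    IsRainbow-⊆ : ∀ {s s′} → s′ ⊆ s → IsRainbow s → IsRainbow s′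
    IsRainbow-⊆ s′⊆s (<r , injective) =
      (λ x → <r x ∘ s′⊆s) , (λ x y x∈ y∈ → injective x y (s′⊆s x∈) (s′⊆s y∈))

    rainbowGraph : (k : ℕ) → KGraph n k
    rainbowGraph k = record
      { edge    = λ s → ⌊ (∣ s ∣ ≟ k) ×-dec isRainbow? s ⌋
      ; uniform = λ s → proj₁ ∘ toWitness
      }

    rainbowGraph-free : ∀ {k} → 2 ≤ k → k ≤ suc r → ¬ ContainsKG (rainbowGraph k) (Kc (suc r) k)
    rainbowGraph-free 2≤k k≤1+r (φ , φ-injective , φ-edge) =
      let i , j , i<j , same = Fin.pigeonhole (n<1+n r) class
      in Fin.<⇒≢ i<j (φ-injective (class-injective i j same))
      where
      rainbowPair : ∀ i j → ∃ λ s → φ i ∈ s × φ j ∈ s × IsRainbow s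
      rainbowPair i j =
        let u , i∈u , j∈u , ∣u∣≡k = superset-of-pair 2≤k k≤1+r i j
        in image φ u , ∈-image⁺ φ i∈u , ∈-image⁺ φ j∈u , proj₂ (toWitness (φ-edge u (≡⇒≡ᵇ _ _ ∣u∣≡k)))
      colour<r : ∀ i → colour (φ i) < r
      colour<r i = let _ , i∈s , _ , s-rainbow = rainbowPair i i in proj₁ s-rainbow _ i∈s
      class : Fin (suc r) → Fin r
      class i = fromℕ< (colour<r i)
      class-injective : ∀ i j → class i ≡ class j → φ i ≡ φ j
      class-injective i j same =
        let _ , i∈s , j∈s , s-rainbow = rainbowPair i j
        in proj₂ s-rainbow _ _ i∈s j∈s
             (trans (sym (Fin.toℕ-fromℕ< _)) (trans (cong toℕ same) (Fin.toℕ-fromℕ< _)))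

    module Transversals {M} (ψ : Fin r → Fin M → Fin n) (colour-ψ : ∀ j i → colour (ψ j i) ≡ toℕ j)
                        (ψ-injective : ∀ j → Injective _≡_ _≡_ (ψ j)) where

      pick : (Fin r → Fin M) → Fin r → Fin n
      pick f j = ψ j (f j)

      transversal : (Fin r → Fin M) → Subset n
      transversal f = image (pick f) ⊤

      pick-colour-injective : ∀ f g {j j′} → colour (pick f j) ≡ colour (pick g j′) → j ≡ j′
      pick-colour-injective f g {j} {j′} eq =
        Fin.toℕ-injective (trans (sym (colour-ψ j _)) (trans eq (colour-ψ j′ _)))

      transversal-rainbow : ∀ f → IsRainbow (transversal f)
      transversal-rainbow f = <r , injective
        where
        <r : ∀ x → x ∈ transversal f → colour x < r
        <r x x∈ with ∈-image⁻ (pick f) x∈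
        ... | j , _ , refl = subst (_< r) (sym (colour-ψ j (f j))) (Fin.toℕ<n j)
        injective : ∀ x y → x ∈ transversal f → y ∈ transversal f → colour x ≡ colour y → x ≡ y
        injective x y x∈ y∈ eq with ∈-image⁻ (pick f) x∈ | ∈-image⁻ (pick f) y∈
        ... | j , _ , refl | j′ , _ , refl = cong (pick f) (pick-colour-injective f f eq)

      ∣transversal∣≡r : ∀ f → ∣ transversal f ∣ ≡ r
      ∣transversal∣≡r f = trans (∣image∣≡∣∣ (pick f) (pick-colour-injective f f ∘ cong colour) ⊤) (∣⊤∣≡n r)

      transversal-injective : ∀ f g → transversal f ≡ transversal g → ∀ j → f j ≡ g j
      transversal-injective f g eq j with ∈-image⁻ (pick g) (subst (pick f j ∈_) eq (∈-image⁺ (pick f) ∈⊤))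
      ... | j′ , _ , pick-g≡pick-f with pick-colour-injective g f (cong colour pick-g≡pick-f)
      ... | refl = sym (ψ-injective j pick-g≡pick-f)

      transversal-isClique : ∀ k f → T (isClique (rainbowGraph k) r (transversal f))
      transversal-isClique k f = isClique⁺ (rainbowGraph k) (∣transversal∣≡r f)
        (λ s⊆T ∣s∣≡k → fromWitness (∣s∣≡k , IsRainbow-⊆ s⊆T (transversal-rainbow f)))

      M^r≤cliqueCopies : ∀ k → M ^ r ≤ cliqueCopies (rainbowGraph k) r
      M^r≤cliqueCopies k = injection⇒≤count (isClique (rainbowGraph k) r) (transversal ∘ finToFun)
        (λ eq → finToFun-injective {M} {r} (transversal-injective _ _ eq))
        (∈-allSubsets ∘ transversal ∘ finToFun) (transversal-isClique k ∘ finToFun)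

  [m*n+o]/m≡n : ∀ m .{{_ : NonZero m}} n {o} → o < m → (m * n + o) / m ≡ n
  [m*n+o]/m≡n m n {o} o<m = begin
    (m * n + o) / m    ≡⟨ +-distrib-/-∣ˡ o (m∣m*n n) ⟩
    m * n / m + o / m  ≡⟨ cong₂ _+_ (trans (cong (_/ m) (*-comm m n)) (m*n/n≡m n m)) (m<n⇒m/n≡0 o<m) ⟩
    n + 0              ≡⟨ +-identityʳ n ⟩
    n                  ∎
    where open ≡-Reasoning

  -- The parts are the blocks [jM, (j+1)M) for j < r; the vertices from rM on have colour ≥ r
  -- and so lie in no edge.
  blockGraph : ∀ {n} k r M .{{_ : NonZero M}} → 2 ≤ k → k ≤ suc r → r * M ≤ n →
               ∃ λ (G : KGraph n k) → ¬ ContainsKG G (Kc (suc r) k) × M ^ r ≤ cliqueCopies G r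
  blockGraph k r M 2≤k k≤1+r rM≤n = rainbowGraph k , rainbowGraph-free 2≤k k≤1+r , M^r≤cliqueCopies k
    where
    open Rainbow (λ x → toℕ x / M) r
    ψ : Fin r → Fin M → Fin _
    ψ j i = inject≤ (combine j i) rM≤n
    colour-ψ : ∀ j i → toℕ (ψ j i) / M ≡ toℕ j
    colour-ψ j i = trans (cong (_/ M) (trans (Fin.toℕ-inject≤ (combine j i) rM≤n) (Fin.toℕ-combine j i)))
                         ([m*n+o]/m≡n M (toℕ j) (Fin.toℕ<n i))
    ψ-injective : ∀ j → Injective _≡_ _≡_ (ψ j)
    ψ-injective j eq = Fin.combine-injectiveʳ j _ j _ (Fin.inject≤-injective rM≤n rM≤n _ _ eq)
    open Transversals ψ colour-ψ ψ-injective

  ^-distribʳ-* : ∀ m n o → (m * n) ^ o ≡ m ^ o * n ^ o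
  ^-distribʳ-* m n zero    = refl
  ^-distribʳ-* m n (suc o) = trans (cong (m * n *_) (^-distribʳ-* m n o)) (interchange m n (m ^ o) (n ^ o))

  m<n*[1+m/n] : ∀ m n .{{_ : NonZero n}} → m < n * suc (m / n)
  m<n*[1+m/n] m n = begin-strict
    m                  ≡⟨ m≡m%n+[m/n]*n m n ⟩
    m % n + m / n * n  <⟨ +-monoˡ-< (m / n * n) (m%n<n m n) ⟩
    n + m / n * n      ≡⟨ cong (_+_ n) (*-comm (m / n) n) ⟩
    n + n * (m / n)    ≡⟨ *-suc n (m / n) ⟨
    n * suc (m / n)    ∎
    where open ≤-Reasoning

  eventually-N*[1+n]^q≤⌊n/r⌋^r : ∀ N q → ∃ λ n₀ → ∀ {n} → n₀ ≤ n → N * suc n ^ q ≤ (n / suc q) ^ suc q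
  eventually-N*[1+n]^q≤⌊n/r⌋^r N q = suc C * r , bound
    where
    r = suc q
    C = N * (2 * r) ^ q
    bound : ∀ {n} → suc C * r ≤ n → N * suc n ^ q ≤ (n / r) ^ r
    bound {n} n₀≤n = begin
      N * suc n ^ q              ≤⟨ *-monoʳ-≤ N (^-monoˡ-≤ q 1+n≤2rM) ⟩
      N * (2 * r * M) ^ q        ≡⟨ cong (N *_) (^-distribʳ-* (2 * r) M q) ⟩
      N * ((2 * r) ^ q * M ^ q)  ≡⟨ *-assoc N _ _ ⟨
      C * M ^ q                  ≤⟨ *-monoˡ-≤ (M ^ q) (<⇒≤ C<M) ⟩
      M * M ^ q                  ∎
      where
      open ≤-Reasoning
      M = n / r
      C<M : C < M
      C<M = subst (_≤ M) (m*n/n≡m (suc C) r) (/-monoˡ-≤ r n₀≤n)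
      1+M≤2M : suc M ≤ 2 * M
      1+M≤2M = begin
        suc M          ≡⟨ +-comm 1 M ⟩
        M + 1          ≤⟨ +-monoʳ-≤ M (≤-trans (s≤s z≤n) C<M) ⟩
        M + M          ≡⟨ cong (_+_ M) (+-identityʳ M) ⟨
        2 * M          ∎
      1+n≤2rM : suc n ≤ 2 * r * M
      1+n≤2rM = begin
        suc n          ≤⟨ m<n*[1+m/n] n r ⟩
        r * suc M      ≤⟨ *-monoʳ-≤ r 1+M≤2M ⟩
        r * (2 * M)    ≡⟨ *-assoc r 2 M ⟨
        r * 2 * M      ≡⟨ cong (_* M) (*-comm r 2) ⟩
        2 * r * M      ∎

  ex≤exSC : ∀ {n k r t a b} → IsExCl n k r t a → IsExSC n K[ t , k ] b → a ≤ b
  ex≤exSC {r = r} ((G , G-free , refl) , _) (_ , b-max) =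
    ≤-trans (cliqueCopies≤edgeCount G r) (b-max (cliqueComplex G r) (cliqueComplex-free G r G-free))

  exSC≤ex+small : ∀ {n k r a b} → k ≤ suc r → IsExCl n k r (suc r) a → IsExSC n K[ suc r , k ] b →
                  b ≤ a + countSubsets {n} (λ s → ∣ s ∣ <ᵇ r)
  exSC≤ex+small {k = k} {r} k≤1+r (_ , a-max) ((H , H-free , refl) , _) =
    ≤-trans (edgeCount≤cliques+small H k r (λ s → ≤-pred ∘ free⇒faces< H H-free s))
            (+-monoˡ-≤ _ (a-max (skeleton H k) (skeleton-free H k≤1+r H-free)))

  ex≥blocks : ∀ {n k r a} → 2 ≤ k → k ≤ suc r → IsExCl n k r (suc r) a → ∀ M → r * M ≤ n → M ^ r ≤ a
  ex≥blocks {r = zero}  (s≤s (s≤s _)) (s≤s ()) _ _ _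
  ex≥blocks {r = suc r} _ _ _ zero _ = z≤n
  ex≥blocks 2≤k k≤1+r (_ , a-max) (suc M) rM≤n =
    let G , G-free , M^r≤cliques = blockGraph _ _ (suc M) 2≤k k≤1+r rM≤n
    in ≤-trans M^r≤cliques (a-max G G-free)

  smallFaces-negligible : ∀ {k q} N → 2 ≤ k → k ≤ suc (suc q) → ∃ λ n₀ → ∀ {n a} → n₀ ≤ n →
                          IsExCl n k (suc q) (suc (suc q)) a → N * countSubsets {n} (λ s → ∣ s ∣ <ᵇ suc q) ≤ a
  smallFaces-negligible {q = q} N 2≤k k≤t =
    let n₀ , N*[1+n]^q≤⌊n/r⌋^r = eventually-N*[1+n]^q≤⌊n/r⌋^r N q
    in n₀ , λ {n} {a} n₀≤n ex → begin
      N * countSubsets {n} (λ s → ∣ s ∣ <ᵇ suc q) ≤⟨ *-monoʳ-≤ N (countSubsets-∣∣<-≤ n q) ⟩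
      N * suc n ^ q                                ≤⟨ N*[1+n]^q≤⌊n/r⌋^r n₀≤n ⟩
      (n / suc q) ^ suc q                          ≤⟨ ex≥blocks 2≤k k≤t ex (n / suc q) r*⌊n/r⌋≤n ⟩
      a                                            ∎
    where
    open ≤-Reasoning
    r*⌊n/r⌋≤n : ∀ {n} → suc q * (n / suc q) ≤ n
    r*⌊n/r⌋≤n {n} = subst (_≤ n) (*-comm (n / suc q) (suc q)) (m/n*n≤m n (suc q))

open import Data.Nat as ℕ using (ℕ; zero; suc; _≤_; _+_; _∸_; z≤n; s≤s)
import Data.Nat.Properties as ℕ
open import Data.Integer as ℤ using (+_; +≤+; +<+)
import Data.Integer.Properties as ℤ
open import Data.Rational as ℚ using (ℚ; 0ℚ; 1ℚ; _/_; _*_; _-_; _<_; mkℚ; toℚᵘ; *<*;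
  NonNegative; Positive; nonNegative; positive) renaming (_+_ to _+ℚ_; _≤_ to _≤ℚ_)
import Data.Rational.Properties as ℚ
open import Data.Rational.Unnormalised as ℚᵘ using (mkℚᵘ; *≤*; *≡*)
import Data.Rational.Unnormalised.Properties as ℚᵘ
open import Data.Product using (_×_; ∃; _,_)
open import Relation.Binary.PropositionalEquality

ι : ℕ → ℚ
ι a = + a / 1

toℚᵘ-ι : ∀ a → toℚᵘ (ι a) ℚᵘ.≃ mkℚᵘ (+ a) 0
toℚᵘ-ι a = ℚ.toℚᵘ-fromℚᵘ (mkℚᵘ (+ a) 0)

ι-mono-≤ : ∀ {a b} → a ≤ b → ι a ≤ℚ ι b
ι-mono-≤ {a} {b} a≤b = ℚ.toℚᵘ-cancel-≤
  (ℚᵘ.≤-respˡ-≃ (ℚᵘ.≃-sym (toℚᵘ-ι a)) (ℚᵘ.≤-respʳ-≃ (ℚᵘ.≃-sym (toℚᵘ-ι b))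
    (*≤* (ℤ.*-monoʳ-≤-nonNeg (+ 1) (+≤+ a≤b)))))

ι-homo-+ : ∀ a b → ι (a + b) ≡ ι a +ℚ ι b
ι-homo-+ a b = ℚ.toℚᵘ-injective (ℚᵘ.≃-trans (toℚᵘ-ι (a + b)) (ℚᵘ.≃-trans (*≡* ℤ-eq)
  (ℚᵘ.≃-sym (ℚᵘ.≃-trans (ℚ.toℚᵘ-homo-+ (ι a) (ι b)) (ℚᵘ.+-cong (toℚᵘ-ι a) (toℚᵘ-ι b))))))
  where
  open ≡-Reasoning
  ℤ-eq : + (a + b) ℤ.* + 1 ≡ (+ a ℤ.* + 1 ℤ.+ + b ℤ.* + 1) ℤ.* + 1
  ℤ-eq = begin
    + (a + b) ℤ.* + 1                      ≡⟨ ℤ.*-identityʳ _ ⟩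
    + a ℤ.+ + b                             ≡⟨ cong₂ ℤ._+_ (ℤ.*-identityʳ (+ a)) (ℤ.*-identityʳ (+ b)) ⟨
    + a ℤ.* + 1 ℤ.+ + b ℤ.* + 1             ≡⟨ ℤ.*-identityʳ _ ⟨
    (+ a ℤ.* + 1 ℤ.+ + b ℤ.* + 1) ℤ.* + 1   ∎

ι-homo-* : ∀ a b → ι (a ℕ.* b) ≡ ι a * ι b
ι-homo-* a b = ℚ.toℚᵘ-injective (ℚᵘ.≃-trans (toℚᵘ-ι (a ℕ.* b))
  (ℚᵘ.≃-trans (*≡* (cong (ℤ._* + 1) (ℤ.pos-* a b)))
  (ℚᵘ.≃-sym (ℚᵘ.≃-trans (ℚ.toℚᵘ-homo-* (ι a) (ι b)) (ℚᵘ.*-cong (toℚᵘ-ι a) (toℚᵘ-ι b))))))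

ι-nonNeg : ∀ a → NonNegative (ι a)
ι-nonNeg a = nonNegative (ι-mono-≤ {b = a} z≤n)

archimedean : ∀ ε → 0ℚ < ε → ∃ λ N → 1ℚ ≤ℚ ι (suc N) * ε
archimedean (mkℚ (+ zero) d c) (*<* (+<+ ()))
archimedean ε@(mkℚ (+ suc p) d c) _ = d , subst (1ℚ ≤ℚ_) (sym Nε≡1+p) (ι-mono-≤ {b = suc p} (s≤s z≤n))
  where
  ℤ-eq : + suc p ℤ.* + (1 ℕ.* suc d) ≡ + suc d ℤ.* + suc p ℤ.* + 1
  ℤ-eq = begin
    + suc p ℤ.* + (1 ℕ.* suc d)  ≡⟨ cong (λ m → + suc p ℤ.* + m) (ℕ.*-identityˡ (suc d)) ⟩
    + suc p ℤ.* + suc d          ≡⟨ ℤ.*-comm (+ suc p) (+ suc d) ⟩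
    + suc d ℤ.* + suc p          ≡⟨ ℤ.*-identityʳ _ ⟨
    + suc d ℤ.* + suc p ℤ.* + 1  ∎
    where open ≡-Reasoning
  Nε≡1+p : ι (suc d) * ε ≡ ι (suc p)
  Nε≡1+p = ℚ.toℚᵘ-injective (ℚᵘ.≃-trans (ℚ.toℚᵘ-homo-* (ι (suc d)) ε)
    (ℚᵘ.≃-trans (ℚᵘ.*-congʳ (toℚᵘ-ι (suc d))) (ℚᵘ.≃-sym (ℚᵘ.≃-trans (toℚᵘ-ι (suc p)) (*≡* ℤ-eq)))))

1-ε-scaled-≤ : ∀ ε → 0ℚ ≤ℚ ε → ∀ {a b} → a ≤ b → (1ℚ - ε) * ι a ≤ℚ ι b
1-ε-scaled-≤ ε 0≤ε {a} {b} a≤b = begin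
  (1ℚ - ε) * ι a  ≤⟨ ℚ.*-monoʳ-≤-nonNeg (ι a) {{ι-nonNeg a}} 1-ε≤1 ⟩
  1ℚ * ι a        ≡⟨ ℚ.*-identityˡ (ι a) ⟩
  ι a             ≤⟨ ι-mono-≤ a≤b ⟩
  ι b             ∎
  where
  open ℚ.≤-Reasoning
  1-ε≤1 : 1ℚ - ε ≤ℚ 1ℚ
  1-ε≤1 = ℚ.≤-trans (ℚ.+-monoʳ-≤ 1ℚ (ℚ.neg-antimono-≤ 0≤ε)) (ℚ.≤-reflexive (ℚ.+-identityʳ 1ℚ))

≤-1+ε-scaled : ∀ ε N → 1ℚ ≤ℚ ι (suc N) * ε → ∀ {a b c} →
               b ≤ a + c → suc N ℕ.* c ≤ a → ι b ≤ℚ (1ℚ +ℚ ε) * ι a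
≤-1+ε-scaled ε N 1≤Nε {a} {b} {c} b≤a+c Nc≤a = begin
  ι b                   ≤⟨ ι-mono-≤ b≤a+c ⟩
  ι (a + c)             ≡⟨ ι-homo-+ a c ⟩
  ι a +ℚ ι c            ≤⟨ ℚ.+-monoʳ-≤ (ι a) c≤εa ⟩
  ι a +ℚ ε * ι a        ≡⟨ cong (_+ℚ ε * ι a) (ℚ.*-identityˡ (ι a)) ⟨
  1ℚ * ι a +ℚ ε * ι a   ≡⟨ ℚ.*-distribʳ-+ (ι a) 1ℚ ε ⟨
  (1ℚ +ℚ ε) * ι a       ∎
  where
  open ℚ.≤-Reasoning
  instance
    N-pos : Positive (ι (suc N))
    N-pos = positive (ℚ.<-≤-trans (ℚ.positive⁻¹ 1ℚ) (ι-mono-≤ {b = suc N} (s≤s z≤n)))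
  c≤εa : ι c ≤ℚ ε * ι a
  c≤εa = ℚ.*-cancelˡ-≤-pos (ι (suc N)) (begin
    ι (suc N) * ι c       ≡⟨ ι-homo-* (suc N) c ⟨
    ι (suc N ℕ.* c)       ≤⟨ ι-mono-≤ Nc≤a ⟩
    ι a                   ≡⟨ ℚ.*-identityˡ (ι a) ⟨
    1ℚ * ι a              ≤⟨ ℚ.*-monoʳ-≤-nonNeg (ι a) {{ι-nonNeg a}} 1≤Nε ⟩
    ι (suc N) * ε * ι a   ≡⟨ ℚ.*-assoc (ι (suc N)) ε (ι a) ⟩
    ι (suc N) * (ε * ι a) ∎)

ex-sandwich : ∀ (k t : ℕ) → 2 ≤ k → k ≤ t →
              ∀ (ε : ℚ) → 0ℚ < ε →
              ∃ λ (n₀ : ℕ) → ∀ (n : ℕ) → n₀ ≤ n →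
              ∀ (a b : ℕ) → IsExCl n k (t ∸ 1) t a → IsExSC n K[ t , k ] b →
              ((1ℚ - ε) * ι a ≤ℚ ι b) × (ι b ≤ℚ (1ℚ +ℚ ε) * ι a)
-- Matching on 2 ≤ t exposes t = q + 2, so that t ∸ 1 computes to q + 1.
ex-sandwich k t 2≤k k≤t ε 0<ε with ℕ.≤-trans 2≤k k≤t
... | s≤s (s≤s _) =
  let N , 1≤Nε = archimedean ε 0<ε
      n₀ , small≪ex = smallFaces-negligible (suc N) 2≤k k≤t
  in n₀ , λ n n₀≤n a b exCl exSC →
       1-ε-scaled-≤ ε (ℚ.<⇒≤ 0<ε) (ex≤exSC exCl exSC) ,
       ≤-1+ε-scaled ε N 1≤Nε (exSC≤ex+small k≤t exCl exSC) (small≪ex n₀≤n exCl)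

mainTheorem10 : ∀ (k t : ℕ) → 2 ≤ k → k + 2 ≤ t →
                  ∀ (ε : ℚ) → 0ℚ < ε →
                  ∃ λ (n₀ : ℕ) → ∀ (n : ℕ) → n₀ ≤ n →
                  ∀ (a b : ℕ) → IsExCl n k (t ∸ 1) t a → IsExSC n K[ t , k ] b →
                  ((1ℚ - ε) * (+ a / 1) ≤ℚ (+ b / 1))
                  × ((+ b / 1) ≤ℚ (1ℚ +ℚ ε) * (+ a / 1))
mainTheorem10 k t 2≤k k+2≤t = ex-sandwich k t 2≤k (ℕ.≤-trans (ℕ.m≤m+n k 2) k+2≤t)
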